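{- Let $\mathbf{f}$ be the Fibonacci word and $(F_k)$ the Fibonacci sequence with $F_0=1$, $F_1=2$. If $k\ge 2$ and $F_{k-1}\le n+1<F_k$, then $\operatorname{nsc}_{\mathbf{f}}(n)=F_{k-1}$.
   Context: The Fibonacci word is $\mathbf{f}=\phi^{\omega}(0)=0100101001001\cdots$, the fixed point of the morphism $\phi(0)=01$, $\phi(1)=0$. The Fibonacci sequence is $F_0=1$, $F_1=2$, $F_k=F_{k-1}+F_{k-2}$ for $k\ge2$. For an infinite word $\mathbf{x}=x_0x_1x_2\cdots$ (indexed from $0$) and $n\ge1$, $\operatorname{nsc}_{\mathbf{x}}(n)=\max\{m\in\mathbb{N}: x_i\cdots x_{i+n-1}\neq x_j\cdots x_{j+n-1}\text{ for all } 0\le i<j\le m-1\}$. -}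

module Defs where

open import Data.Nat using (ℕ; zero; suc; _+_; _<_; _≤_)
open import Data.Bool using (Bool; true; false)
open import Data.List using (List; []; _∷_; _++_; concatMap; lookup; length)
open import Data.Product using (_×_)
open import Relation.Binary.PropositionalEquality using (_≡_)
open import Relation.Nullary using (¬_)

-- Letters: false = 0, true = 1.
-- The Fibonacci morphism φ(0) = 01, φ(1) = 0.
φ : Bool → List Bool
φ false = false ∷ true ∷ []
φ true  = false ∷ []

φ* : List Bool → List Bool
φ* = concatMap φ

φ^ : ℕ → List Bool
φ^ zero    = false ∷ []
φ^ (suc k) = φ* (φ^ k)

-- safe indexing with default (never used out of range below, since |φ^(i+1)(0)| > i)
index : List Bool → ℕ → Bool
index []       _       = false
index (b ∷ _)  zero    = b
index (_ ∷ bs) (suc i) = index bs i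

-- The Fibonacci word f = φ^ω(0), indexed from 0: f_i is the i-th letter of
-- φ^(i+1)(0), which is a prefix of f of length > i.
fibWord : ℕ → Bool
fibWord i = index (φ^ (suc i)) i

F : ℕ → ℕ
F zero          = 1
F (suc zero)    = 2
F (suc (suc k)) = F (suc k) + F k

SameFactor : (ℕ → Bool) → ℕ → ℕ → ℕ → Set
SameFactor x n i j = ∀ t → t < n → x (i + t) ≡ x (j + t)

FirstFactorsDistinct : (ℕ → Bool) → ℕ → ℕ → Set
FirstFactorsDistinct x n m = ∀ i j → i < j → j < m → ¬ SameFactor x n i j

NscIs : (ℕ → Bool) → ℕ → ℕ → Set
NscIs x n m = FirstFactorsDistinct x n m × (∀ m' → FirstFactorsDistinct x n m' → m' ≤ m)

module Submission where

-- Write f for the Fibonacci word and F for the Fibonacci numbers.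
--   * Since φ^(m+2)(0) = φ^(m+1)(0) φ^m(0) and |φ^m(0)| = F m, the word f begins
--     with every φ^m(0), and f(F(m+1) + s) = f(s) for s < F m.
--   * By induction this gives the classical near-periodicity: the prefix of f of
--     length F(m+2) − 2 has period F m, while the period F(m+1) breaks exactly at
--     position F(m+2) − 2 (the last two letters of φ^m(0) alternate with m).
--   * Lower bound: by strong induction on m (cases on where i < j < F(m+2) lie
--     relative to F(m+1)), the factors of length F m − 1 starting at positions
--     0, …, F m − 1 are pairwise distinct; shifting a factor by F(m+1) reduces
--     to the two previous levels, and the only uncovered case is a factor
--     compared with its own F(m+1)-shift, excluded by the broken period.
--   * Upper bound: if n + 1 < F k, periodicity makes the factors at 0 and F(k−1)
--     equal, and a repeated factor at j bounds nsc by j.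

open import Defs
open import Data.Nat using (ℕ; _≤_; _<_; _+_; _∸_)
open import Data.Nat using (zero; suc; pred; >-nonZero; _≤′_; ≤′-refl; ≤′-step; z≤n; s≤s; _<?_; _≤?_)
open import Data.Nat.Properties
open import Data.Bool using (Bool)
open import Data.List using (List; []; _∷_; _++_; length)
open import Data.List.Properties using (concatMap-++; length-++)
open import Data.Product using (_×_; _,_; ∃)
open import Data.Sum using (_⊎_; inj₁; inj₂)
open import Data.Empty using (⊥)
open import Relation.Nullary using (¬_; yes; no)
open import Relation.Nullary.Negation using (contradiction)
open import Relation.Binary using (Tri; tri<; tri≈; tri>)
open import Relation.Binary.PropositionalEquality

f : ℕ → Bool
f = fibWord

F-pos : ∀ m → 1 ≤ F m
F-pos zero                = s≤s z≤n
F-pos (suc zero)          = s≤s z≤n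
F-pos (suc (suc m))       = ≤-trans (F-pos (suc m)) (m≤m+n (F (suc m)) (F m))

F-≥2 : ∀ m → 2 ≤ F (suc m)
F-≥2 zero    = s≤s (s≤s z≤n)
F-≥2 (suc m) = ≤-trans (F-≥2 m) (m≤m+n (F (suc m)) (F m))

F-step : ∀ m → F m ≤ F (suc m)
F-step zero    = s≤s z≤n
F-step (suc m) = m≤m+n (F (suc m)) (F m)

F-mono : ∀ {m m'} → m ≤′ m' → F m ≤ F m'
F-mono ≤′-refl        = ≤-refl
F-mono {m' = suc m'} (≤′-step m≤m') = ≤-trans (F-mono m≤m') (F-step m')

-- Needed so that position m of f lies inside the prefix φ^m(0).
n<F : ∀ m → m < F m
n<F zero          = s≤s z≤n
n<F (suc zero)    = s≤s (s≤s z≤n)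
n<F (suc (suc m)) = ≤-trans (s≤s (n<F (suc m)))
  (subst (_≤ F (suc m) + F m) (+-comm (F (suc m)) 1) (+-monoʳ-≤ (F (suc m)) (F-pos m)))

-- F m ≥ 1, so a window of length F m − 1 is written pred (F m).
suc-pred-F : ∀ m → suc (pred (F m)) ≡ F m
suc-pred-F m = suc-pred (F m) {{>-nonZero (F-pos m)}}

φ^-split : ∀ m → φ^ (suc (suc m)) ≡ φ^ (suc m) ++ φ^ m
φ^-split zero    = refl
φ^-split (suc m) = trans (cong φ* (φ^-split m)) (concatMap-++ φ (φ^ (suc m)) (φ^ m))

length-φ^ : ∀ m → length (φ^ m) ≡ F m
length-φ^ zero          = refl
length-φ^ (suc zero)    = refl
length-φ^ (suc (suc m)) = begin
  length (φ^ (suc (suc m)))             ≡⟨ cong length (φ^-split m) ⟩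
  length (φ^ (suc m) ++ φ^ m)           ≡⟨ length-++ (φ^ (suc m)) ⟩
  length (φ^ (suc m)) + length (φ^ m)   ≡⟨ cong₂ _+_ (length-φ^ (suc m)) (length-φ^ m) ⟩
  F (suc m) + F m                       ∎
  where open ≡-Reasoning

index-++ˡ : ∀ (xs ys : List Bool) i → i < length xs → index (xs ++ ys) i ≡ index xs i
index-++ˡ (x ∷ xs) ys zero    _         = refl
index-++ˡ (x ∷ xs) ys (suc i) (s≤s i<) = index-++ˡ xs ys i i<

index-++ʳ : ∀ (xs ys : List Bool) s → index (xs ++ ys) (length xs + s) ≡ index ys s
index-++ʳ []       ys s = refl
index-++ʳ (x ∷ xs) ys s = index-++ʳ xs ys s

index-φ^-step : ∀ m i → i < F m → index (φ^ (suc m)) i ≡ index (φ^ m) i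
index-φ^-step zero    zero    _ = refl
index-φ^-step zero    (suc i) (s≤s ())
index-φ^-step (suc m) i       i< = trans (cong (λ w → index w i) (φ^-split m))
  (index-++ˡ (φ^ (suc m)) (φ^ m) i (subst (i <_) (sym (length-φ^ (suc m))) i<))

index-φ^-mono : ∀ {m m'} i → m ≤′ m' → i < F m → index (φ^ m') i ≡ index (φ^ m) i
index-φ^-mono i ≤′-refl        i< = refl
index-φ^-mono {m' = suc m'} i (≤′-step m≤m') i< =
  trans (index-φ^-step m' i (≤-trans i< (F-mono m≤m'))) (index-φ^-mono i m≤m' i<)

fibWord-prefix : ∀ m i → i < F m → f i ≡ index (φ^ m) i
fibWord-prefix m i i< with ≤-total (suc i) m
... | inj₁ i+1≤m = sym (index-φ^-mono i (≤⇒≤′ i+1≤m) (≤-trans (n<F i) (F-step i)))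
... | inj₂ m≤i+1 = index-φ^-mono i (≤⇒≤′ m≤i+1) i<

-- Reading f from F(m+1) inside φ^(m+2)(0) = φ^(m+1)(0) φ^m(0) reads φ^m(0).
shift-F : ∀ m s → s < F m → f (F (suc m) + s) ≡ f s
shift-F m s s< = begin
  f (F (suc m) + s)
    ≡⟨ fibWord-prefix (suc (suc m)) (F (suc m) + s) (+-monoʳ-< (F (suc m)) s<) ⟩
  index (φ^ (suc (suc m))) (F (suc m) + s)
    ≡⟨ cong₂ index (φ^-split m) (cong (_+ s) (sym (length-φ^ (suc m)))) ⟩
  index (φ^ (suc m) ++ φ^ m) (length (φ^ (suc m)) + s)
    ≡⟨ index-++ʳ (φ^ (suc m)) (φ^ m) s ⟩
  index (φ^ m) s
    ≡⟨ sym (fibWord-prefix m s s<) ⟩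
  f s ∎
  where open ≡-Reasoning

period-F : ∀ m t → 2 + t < F (suc m) → f (F m + t) ≡ f t
period-F zero    t (s≤s (s≤s ()))
period-F (suc m) t bound with t <? F m
... | yes t< = shift-F m t t<
... | no t≮ with m≤n⇒∃[o]m+o≡n (≮⇒≥ t≮)
...   | s , refl = begin
  f (F (suc m) + (F m + s))   ≡⟨ cong f (sym (+-assoc (F (suc m)) (F m) s)) ⟩
  f (F (suc (suc m)) + s)     ≡⟨ shift-F (suc m) s (m+n≤o⇒n≤o 2 bound′) ⟩
  f s                         ≡⟨ sym (period-F m s bound′) ⟩
  f (F m + s)                 ∎
  where
  open ≡-Reasoning
  move-2 : 2 + (F m + s) ≡ F m + (2 + s)
  move-2 = sym (trans (+-suc (F m) (suc s)) (cong suc (+-suc (F m) s)))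
  bound′ : 2 + s < F (suc m)
  bound′ = +-cancelˡ-< (F m) (2 + s) (F (suc m))
    (subst₂ _<_ move-2 (+-comm (F (suc m)) (F m)) bound)

-- The period F(m+1) fails at position F(m+2) − 2: the last letters of φ^(m+1)(0)
-- and φ^(m+2)(0) differ.
period-breaks : ∀ m → f (F (suc m) ∸ 2) ≢ f (F (suc (suc m)) ∸ 2)
period-breaks zero    ()
period-breaks (suc m) eq = period-breaks m (sym (trans eq back))
  where
  back : f (F (suc (suc (suc m))) ∸ 2) ≡ f (F (suc m) ∸ 2)
  back = trans (cong f (+-∸-assoc (F (suc (suc m))) (F-≥2 m)))
               (shift-F (suc m) (F (suc m) ∸ 2) (∸-monoʳ-< {o = 0} (s≤s z≤n) (F-≥2 m)))

SameFactor-sym : ∀ x {n} i j → SameFactor x n i j → SameFactor x n j i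
SameFactor-sym x i j same t t<n = sym (same t t<n)

SameFactor-trans : ∀ x {n} i j k → SameFactor x n i j → SameFactor x n j k → SameFactor x n i k
SameFactor-trans x i j k same₁ same₂ t t<n = trans (same₁ t t<n) (same₂ t t<n)

SameFactor-shorten : ∀ x {n n'} i j → n' ≤ n → SameFactor x n i j → SameFactor x n' i j
SameFactor-shorten x i j n'≤n same t t<n' = same t (<-≤-trans t<n' n'≤n)

repeat-bounds-nsc : ∀ x n i j m → i < j → SameFactor x n i j → FirstFactorsDistinct x n m → m ≤ j
repeat-bounds-nsc x n i j m i<j same distinct with m ≤? j
... | yes m≤j = m≤j
... | no m≰j  = contradiction same (distinct i j i<j (≰⇒> m≰j))

split-below : ∀ a b j → j < a + b → j < a ⊎ ∃ λ j' → j ≡ a + j' × j' < b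
split-below a b j j< with j <? a
... | yes j<a = inj₁ j<a
... | no j≮a with m≤n⇒∃[o]m+o≡n (≮⇒≥ j≮a)
...   | j' , refl = inj₂ (j' , refl , +-cancelˡ-< a j' b j<)

shift-factor : ∀ m i n → suc (i + n) < F (suc m) → SameFactor f n (F m + i) i
shift-factor m i n bound t t<n =
  trans (cong f (+-assoc (F m) i t))
        (period-F m (i + t) (≤-trans (s≤s (s≤s (+-monoʳ-< i t<n))) bound))

shift-window : ∀ m i n → i < F m → suc n ≤ F (suc m) → SameFactor f n (F (suc m) + i) i
shift-window m i n i< n< = shift-factor (suc m) i n (begin-strict
  suc (i + n)       <⟨ s≤s (≤-reflexive (sym (+-suc i n))) ⟩
  suc i + suc n     ≤⟨ +-mono-≤ i< n< ⟩
  F m + F (suc m)   ≡⟨ +-comm (F m) (F (suc m)) ⟩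
  F (suc (suc m))   ∎)
  where open ≤-Reasoning

-- A long enough factor starting at j < F m is never repeated F(m+1) positions
-- later: the comparison reaches position F(m+2) − 2 where that period breaks.
no-shifted-repeat : ∀ m n j → F (suc (suc m)) ≤ suc n → j < F m →
  ¬ SameFactor f n j (F (suc m) + j)
no-shifted-repeat m n j long j< same = period-breaks (suc m) (begin
  f X                               ≡⟨ cong f (sym j+t≡X) ⟩
  f (j + t)                         ≡⟨ same t t<n ⟩
  f (F (suc m) + j + t)             ≡⟨ cong f (trans (+-assoc (F (suc m)) j t) (cong (F (suc m) +_) j+t≡X)) ⟩
  f (F (suc m) + X)                 ≡⟨ cong f shifted-X ⟩
  f (F (suc (suc (suc m))) ∸ 2)     ∎)
  where
  open ≡-Reasoning
  X = F (suc (suc m)) ∸ 2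
  t = X ∸ j
  2+X : 2 + X ≡ F (suc (suc m))
  2+X = m+[n∸m]≡n (F-≥2 (suc m))
  j≤X : j ≤ X
  j≤X = +-cancelˡ-≤ 2 j X (subst (2 + j ≤_) (sym 2+X) (+-mono-≤ (F-pos (suc m)) j<))
  j+t≡X : j + t ≡ X
  j+t≡X = m+[n∸m]≡n j≤X
  t<n : t < n
  t<n = ≤-<-trans (m∸n≤m X j) (≤-pred (subst (_≤ suc n) (sym 2+X) long))
  shifted-X : F (suc m) + X ≡ F (suc (suc (suc m))) ∸ 2
  shifted-X = sym (trans (cong (_∸ 2) (+-comm (F (suc (suc m))) (F (suc m))))
                         (+-∸-assoc (F (suc m)) (F-≥2 (suc m))))

Distinct : ℕ → Set
Distinct m = ∀ n → F m ≤ suc n → FirstFactorsDistinct f n (F m)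

window : ∀ m → F m ≤ suc (pred (F m))
window m = ≤-reflexive (sym (suc-pred-F m))

-- Induction step, case i < F(m+1) ≤ j = F(m+1) + j': shifting the factor at j
-- back to j' compares i with j' at level m+1, unless i = j'.
distinct-straddle : ∀ m → Distinct (suc m) → ∀ n i j' → F (suc (suc m)) ≤ suc n →
  i < F (suc m) → j' < F m → ¬ SameFactor f n i (F (suc m) + j')
distinct-straddle m distinct₁ n i j' long i< j'< same = compare (<-cmp i j')
  where
  n₁ = pred (F (suc m))
  same₁ : SameFactor f n₁ i j'
  same₁ = SameFactor-trans f i (F (suc m) + j') j'
    (SameFactor-shorten f i (F (suc m) + j') (pred-mono-≤ (≤-trans (F-step (suc m)) long)) same)
    (shift-window m j' n₁ j'< (≤-reflexive (suc-pred-F (suc m))))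
  compare : Tri (i < j') (i ≡ j') (j' < i) → ⊥
  compare (tri< i<j' _ _)  = distinct₁ n₁ (window (suc m)) i j' i<j' (≤-trans j'< (F-step m)) same₁
  compare (tri≈ _ refl _)  = no-shifted-repeat m n i long j'< same
  compare (tri> _ _ j'<i)  = distinct₁ n₁ (window (suc m)) j' i j'<i i< (SameFactor-sym f i j' same₁)

-- Induction step, case F(m+1) ≤ i < j: shifting both factors back by F(m+1)
-- contradicts level m.
distinct-high : ∀ m → Distinct m → ∀ n i' j' → F (suc (suc m)) ≤ suc n →
  i' < j' → j' < F m → ¬ SameFactor f n (F (suc m) + i') (F (suc m) + j')
distinct-high m distinct₀ n i' j' long i'<j' j'< same =
  distinct₀ n₀ (window m) i' j' i'<j' j'<
    (SameFactor-trans f i' (F (suc m) + i') j'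
      (SameFactor-sym f (F (suc m) + i') i' (shift-window m i' n₀ (<-trans i'<j' j'<) n₀<))
      (SameFactor-trans f (F (suc m) + i') (F (suc m) + j') j'
        (SameFactor-shorten f (F (suc m) + i') (F (suc m) + j') n₀≤n same)
        (shift-window m j' n₀ j'< n₀<)))
  where
  n₀ = pred (F m)
  n₀< : suc n₀ ≤ F (suc m)
  n₀< = subst (_≤ F (suc m)) (sym (suc-pred-F m)) (F-step m)
  n₀≤n : n₀ ≤ n
  n₀≤n = pred-mono-≤ (≤-trans (≤-trans (F-step m) (F-step (suc m))) long)

distinct-step : ∀ m → Distinct (suc m) → Distinct m → Distinct (suc (suc m))
distinct-step m distinct₁ distinct₀ n long i j i<j j< same
  with split-below (F (suc m)) (F m) j j<
... | inj₁ j<F₁ = distinct₁ n (≤-trans (F-step (suc m)) long) i j i<j j<F₁ same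
... | inj₂ (j' , refl , j'<) with split-below (F (suc m)) (F m) i (<-trans i<j j<)
...   | inj₁ i<F₁              = distinct-straddle m distinct₁ n i j' long i<F₁ j'< same
...   | inj₂ (i' , refl , _)   =
  distinct-high m distinct₀ n i' j' long (+-cancelˡ-< (F (suc m)) i' j' i<j) j'< same

-- Base cases: F 0 = 1 leaves no pairs; F 1 = 2 compares f 0 = 0 with f 1 = 1.
distinct : ∀ m → Distinct m
distinct zero          n _ i (suc j) _ (s≤s ())
distinct (suc zero)    n (s≤s 1≤n) zero (suc zero) _ _ same with same 0 1≤n
... | ()
distinct (suc zero)    n _ (suc i) (suc zero) (s≤s ()) _ _
distinct (suc zero)    n _ i (suc (suc j)) _ (s≤s (s≤s ())) _
distinct (suc (suc m)) = distinct-step m (distinct (suc m)) (distinct m)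

-- With k = m + 2: Distinct (m+1) gives the lower bound, and the repetition of the
-- factor at 0 at position F(m+1) gives the upper bound.
mainTheorem3 : ∀ (k n : ℕ) → 2 ≤ k → 1 ≤ n → F (k ∸ 1) ≤ n + 1 → n + 1 < F k →
    NscIs fibWord n (F (k ∸ 1))
mainTheorem3 (suc (suc m)) n (s≤s (s≤s z≤n)) _ lo hi =
  distinct (suc m) n (subst (F (suc m) ≤_) (+-comm n 1) lo) ,
  λ m' → repeat-bounds-nsc fibWord n 0 (F (suc m)) m' (F-pos (suc m)) repeated
  where
  -- n + 1 < F k, so the factor at 0 reappears F(k−1) positions later
  repeated : SameFactor fibWord n 0 (F (suc m))
  repeated = SameFactor-sym fibWord (F (suc m)) 0
    (subst (λ p → SameFactor fibWord n p 0) (+-identityʳ (F (suc m)))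
      (shift-factor (suc m) 0 n (subst (_< F (suc (suc m))) (+-comm n 1) hi)))
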